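{- Let $T$ be a nonempty set of positive integers, each less than $m$, with $|T|=q$, and let $N$ be a positive integer such that every element of $T$ is coprime to $N$. If $A$ is a subset of an abelian group $G$ of order $N$ such that there is no nonzero $y\in G$ with $ty\in A-A$ for all $t\in T$, then $|A-A|\ge |A|^{1+1/(2^qm)}$.
   Context: $A-A=\{a-b:a,b\in A\}$; $ty$ denotes the $t$-fold sum $y+\dots+y$. -}

module Defs where

open import Data.Nat using (ℕ; zero; suc)
open import Data.Fin using (Fin)
open import Algebra.Core using (Op₂)

times : {N : ℕ} → Op₂ (Fin N) → Fin N → ℕ → Fin N → Fin N
times _∙_ ε zero    y = ε
times _∙_ ε (suc t) y = y ∙ times _∙_ ε t y

{-# OPTIONS --safe #-}

-- Write n = |A| and d = |A − A|.  Petridis' lemma and the Ruzsa triangle inequality give the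
-- Plünnecke–Ruzsa bound |hA − lA| ≤ (d/n)^(h+l) n.  For t coprime to N the dilate
-- W_t = {y : ty ∈ A} has n elements, and y ↦ rty embeds W_t − W_r into rA − tA, so
-- |W_t − W_r| ≤ (d/n)^(2m) n for t, r ∈ T.  Starting from S = W_t₁, intersect S with a
-- translate of W_r for each further r ∈ T, chosen by pigeonhole so that at most a factor
-- (n/d)^(2m) of S is lost.  The final S satisfies t(S − S) ⊆ A − A for every t ∈ T, so by
-- hypothesis it has at most one element: n (n/d)^(2m(q−1)) ≤ 1, which implies the claim as n ≤ d.

module Submission where

open import Defs
open import Data.Nat using (ℕ; _<_; _≤_; _+_; _*_; _^_)
open import Data.Nat.Coprimality using (Coprime)
open import Data.Fin using (Fin)
open import Data.Fin.Subset using (Subset; _∈_; ∣_∣)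
open import Data.List using (List; length)
open import Data.List.Relation.Unary.All using (All)
open import Data.List.Relation.Unary.Unique.Propositional using (Unique)
open import Data.List.Membership.Propositional using () renaming (_∈_ to _∈ₗ_)
open import Data.Product using (Σ; ∃; _×_)
open import Relation.Binary.PropositionalEquality using (_≡_; _≢_)
open import Relation.Nullary using (¬_)
open import Algebra.Core using (Op₁; Op₂)
open import Algebra.Structures using (IsAbelianGroup)
open import Function.Bundles using (_⇔_)

open import Data.Nat using (zero; suc; _∸_; z≤n; s≤s; _≤?_; _<?_)
open import Data.Nat.Base using (>-nonZero)
open import Data.Nat.Properties hiding (_≟_)
open import Data.Nat.Tactic.RingSolver using (solve-∀)
open import Data.Nat.Coprimality using (coprime-Bézout)
open import Data.Nat.GCD using (module Bézout)
open import Data.Bool using (Bool; true; false; T; _∧_; not; if_then_else_)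
open import Data.Bool.Properties using (T-∧; T-∨; T-≡)
open import Data.Bool.ListAction using (any)
open import Data.Empty using (⊥-elim)
open import Data.Fin using (_≟_)
import Data.Fin as Fin
open import Data.Fin.Permutation using (Permutation; permutation)
open import Data.Vec using ([]; _∷_; lookup)
import Data.Vec as Vec
open import Data.Vec.Properties using (lookup∘tabulate; []=⇒lookup; lookup⇒[]=)
open import Data.List using ([]; _∷_; map; _++_; filter; filterᵇ; cartesianProduct; allFin; tabulate)
open import Data.List.Properties using (length-++; filter-++; length-map; length-removeAt′; map-tabulate)
open import Data.List.Extrema.Nat using (argmax; f[xs]≤f[argmax])
open import Data.List.Relation.Unary.All using ([]; _∷_)
import Data.List.Relation.Unary.All as All
open import Data.List.Relation.Unary.All.Properties using (all-filter)
open import Data.List.Relation.Unary.AllPairs using ([]; _∷_)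
open import Data.List.Relation.Unary.Any as Any using (here; there; index; _─_; satisfied)
open import Data.List.Relation.Unary.Any.Properties using (any⁺; any⁻)
import Data.List.Relation.Unary.Unique.Propositional.Properties as Unique
open import Data.List.Membership.Propositional using (find)
open import Data.List.Membership.Propositional.Properties
  using (∈-allFin; ∈-cartesianProduct⁺; ∈-filter⁺; ∈-filter⁻; ∈-map⁺; ∈-map⁻;
         ∈-++⁺ˡ; ∈-++⁺ʳ)
open import Data.List.Relation.Binary.Subset.Propositional using () renaming (_⊆_ to _⊆ₗ_)
open import Data.Product using (∃₂; _,_; proj₁; proj₂)
open import Data.Sum using (_⊎_; inj₁; inj₂)
open import Function using (_∘_; case_of_; Equivalence; mk⇔)
open import Function.Definitions using (Injective)
open import Relation.Binary.PropositionalEquality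
open import Relation.Nullary using (yes; no; T?)
open import Relation.Nullary.Decidable using (⌊_⌋; toWitness; fromWitness; decidable-stable)
open import Algebra.Bundles using (AbelianGroup)
import Algebra.Properties.AbelianGroup as AbelianGroupProperties
import Algebra.Properties.CommutativeSemigroup as CommutativeSemigroupProperties
import Algebra.Properties.Monoid.Mult as MonoidMultProperties
import Algebra.Properties.CommutativeMonoid.Mult as CommutativeMonoidMultProperties
import Algebra.Properties.CommutativeMonoid.Sum as CommutativeMonoidSumProperties
import Algebra.Definitions.RawMonoid as RawMonoidDefinitions

open CommutativeSemigroupProperties *-commutativeSemigroup using () renaming
  (interchange to *-interchange; x∙yz≈y∙xz to *-x∙yz≈y∙xz; x∙yz≈z∙yx to *-x∙yz≈z∙yx;
   xy∙z≈y∙xz to *-xy∙z≈y∙xz; xy∙z≈xz∙y to *-xy∙z≈xz∙y)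
open CommutativeSemigroupProperties +-commutativeSemigroup using () renaming
  (xy∙z≈x∙zy to +-xy∙z≈x∙zy; x∙yz≈xz∙y to +-x∙yz≈xz∙y)

private
  variable
    A B : Set

^-distribʳ-* : ∀ a b e → (a * b) ^ e ≡ a ^ e * b ^ e
^-distribʳ-* a b zero    = refl
^-distribʳ-* a b (suc e) = trans (cong (a * b *_) (^-distribʳ-* a b e)) (*-interchange a b (a ^ e) (b ^ e))

petridis-inequality : ∀ {x k p p′ q q′ y y′} → p′ + y′ ≤ p + k → q + x ≤ q′ + y →
                      x * p ≤ k * q → k * y ≤ y′ * x → x * p′ ≤ k * q′
petridis-inequality {x} {k} {p} {p′} {q} {q′} {y} {y′} p′+y′≤p+k q+x≤q′+y xp≤kq ky≤y′x =
  +-cancelʳ-≤ (x * y′) (x * p′) (k * q′) (begin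
    x * p′ + x * y′   ≡⟨ *-distribˡ-+ x p′ y′ ⟨
    x * (p′ + y′)     ≤⟨ *-monoʳ-≤ x p′+y′≤p+k ⟩
    x * (p + k)       ≡⟨ *-distribˡ-+ x p k ⟩
    x * p + x * k     ≤⟨ +-mono-≤ xp≤kq (≤-reflexive (*-comm x k)) ⟩
    k * q + k * x     ≡⟨ *-distribˡ-+ k q x ⟨
    k * (q + x)       ≤⟨ *-monoʳ-≤ k q+x≤q′+y ⟩
    k * (q′ + y)      ≡⟨ *-distribˡ-+ k q′ y ⟩
    k * q′ + k * y    ≤⟨ +-monoʳ-≤ (k * q′) (≤-trans ky≤y′x (≤-reflexive (*-comm y′ x))) ⟩
    k * q′ + x * y′   ∎)
  where open ≤-Reasoning

rescale-ratio : ∀ {x n k d L} e → 0 < x → x ≤ n → k * n ≤ d * x →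
                x ^ e * L ≤ k ^ e * x → n ^ e * L ≤ d ^ e * n
rescale-ratio {x} {n} {k} {d} {L} e 0<x x≤n kn≤dx bound =
  *-cancelˡ-≤ (x ^ e) {{>-nonZero (m^n>0 x {{>-nonZero 0<x}} e)}} (begin
    x ^ e * (n ^ e * L)    ≡⟨ *-x∙yz≈y∙xz (x ^ e) (n ^ e) L ⟩
    n ^ e * (x ^ e * L)    ≤⟨ *-monoʳ-≤ (n ^ e) bound ⟩
    n ^ e * (k ^ e * x)    ≡⟨ *-x∙yz≈y∙xz (n ^ e) (k ^ e) x ⟩
    k ^ e * (n ^ e * x)    ≡⟨ *-assoc (k ^ e) (n ^ e) x ⟨
    k ^ e * n ^ e * x      ≡⟨ cong (_* x) (^-distribʳ-* k n e) ⟨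
    (k * n) ^ e * x        ≤⟨ *-monoˡ-≤ x (^-monoˡ-≤ e kn≤dx) ⟩
    (d * x) ^ e * x        ≡⟨ cong (_* x) (^-distribʳ-* d x e) ⟩
    d ^ e * x ^ e * x      ≡⟨ *-xy∙z≈y∙xz (d ^ e) (x ^ e) x ⟩
    x ^ e * (d ^ e * x)    ≤⟨ *-monoʳ-≤ (x ^ e) (*-monoʳ-≤ (d ^ e) x≤n) ⟩
    x ^ e * (d ^ e * n)    ∎)
  where open ≤-Reasoning

raise-exponent : ∀ {a b L c e e′} → a ≤ b → e ≤ e′ →
                 a ^ e * L ≤ b ^ e * c → a ^ e′ * L ≤ b ^ e′ * c
raise-exponent {a} {b} {L} {c} {e} {e′} a≤b e≤e′ bound =
  subst (λ i → a ^ i * L ≤ b ^ i * c) (m+[n∸m]≡n e≤e′) (begin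
    a ^ (e + f) * L        ≡⟨ cong (_* L) (^-distribˡ-+-* a e f) ⟩
    a ^ e * a ^ f * L      ≡⟨ *-xy∙z≈y∙xz (a ^ e) (a ^ f) L ⟩
    a ^ f * (a ^ e * L)    ≤⟨ *-mono-≤ (^-monoˡ-≤ f a≤b) bound ⟩
    b ^ f * (b ^ e * c)    ≡⟨ *-xy∙z≈y∙xz (b ^ e) (b ^ f) c ⟨
    b ^ e * b ^ f * c      ≡⟨ cong (_* c) (^-distribˡ-+-* b e f) ⟨
    b ^ (e + f) * c        ∎)
  where
  open ≤-Reasoning
  f : ℕ
  f = e′ ∸ e

n≤2^n : ∀ n → n ≤ 2 ^ n
n≤2^n zero    = z≤n
n≤2^n (suc n) = +-mono-≤ (m^n>0 2 n) (≤-trans (n≤2^n n) (m≤m+n (2 ^ n) 0))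

^-+1-bound : ∀ {d} n M → (0 < n → n ^ M * n ≤ d ^ M) → n ^ (M + 1) ≤ d ^ M
^-+1-bound {d} n M bound =
  subst (_≤ d ^ M) (sym (trans (^-distribˡ-+-* n M 1) (cong (n ^ M *_) (*-identityʳ n)))) (bound′ n bound)
  where
  bound′ : ∀ n → (0 < n → n ^ M * n ≤ d ^ M) → n ^ M * n ≤ d ^ M
  bound′ zero    _     = subst (_≤ d ^ M) (sym (*-zeroʳ (0 ^ M))) z≤n
  bound′ (suc n) bound = bound (s≤s z≤n)

*-double : ∀ a m → a * (m + m) ≡ 2 * a * m
*-double = solve-∀

cross-mul-trans : ∀ {a b c d e f} → 0 < d → a * d ≤ c * b → c * f ≤ e * d → a * f ≤ e * b
cross-mul-trans {a} {b} {c} {d} {e} {f} 0<d ad≤cb cf≤ed = *-cancelˡ-≤ d {{>-nonZero 0<d}} (begin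
  d * (a * f)  ≡⟨ *-x∙yz≈z∙yx d a f ⟩
  f * (a * d)  ≤⟨ *-monoʳ-≤ f ad≤cb ⟩
  f * (c * b)  ≡⟨ *-x∙yz≈z∙yx f c b ⟩
  b * (c * f)  ≤⟨ *-monoʳ-≤ b cf≤ed ⟩
  b * (e * d)  ≡⟨ *-x∙yz≈z∙yx b e d ⟩
  d * (e * b)  ∎)
  where open ≤-Reasoning

∈-─⁺ : ∀ {x z : A} {ys} (x∈ys : x ∈ₗ ys) → z ∈ₗ ys → z ≢ x → z ∈ₗ (ys ─ x∈ys)
∈-─⁺ (here refl)  (here refl)  z≢x = ⊥-elim (z≢x refl)
∈-─⁺ (here refl)  (there z∈ys) _   = z∈ys
∈-─⁺ (there x∈ys) (here refl)  _   = here refl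
∈-─⁺ (there x∈ys) (there z∈ys) z≢x = there (∈-─⁺ x∈ys z∈ys z≢x)

Unique-⊆⇒length≤ : ∀ {xs ys : List A} → Unique xs → xs ⊆ₗ ys → length xs ≤ length ys
Unique-⊆⇒length≤ {xs = []}              _               _     = z≤n
Unique-⊆⇒length≤ {xs = x ∷ xs} {ys} (x∉xs ∷ xs-unique) xs⊆ys =
  subst (suc (length xs) ≤_) (sym (length-removeAt′ ys (index x∈ys)))
    (s≤s (Unique-⊆⇒length≤ xs-unique λ z∈xs →
      ∈-─⁺ x∈ys (xs⊆ys (there z∈xs)) (λ z≡x → All.lookup x∉xs z∈xs (sym z≡x))))
  where
  x∈ys : x ∈ₗ ys
  x∈ys = xs⊆ys (here refl)

-- Sets are Boolean predicates; `size` counts them along the enumeration of a `Finite` type.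

infixr 7 _∩_ _∖_ _⊗_ _⋉_
infix 4 _⊆_ _≐_

_∩_ _∖_ : (P Q : A → Bool) → A → Bool
(P ∩ Q) x = P x ∧ Q x
(P ∖ Q) x = P x ∧ not (Q x)

_⊗_ : (A → Bool) → (B → Bool) → A × B → Bool
(P ⊗ Q) (x , y) = P x ∧ Q y

_⋉_ : (A → Bool) → (A → B → Bool) → A × B → Bool
(P ⋉ Q) (x , y) = P x ∧ Q x y

_⊆_ _≐_ : (P Q : A → Bool) → Set
P ⊆ Q = ∀ {x} → T (P x) → T (Q x)
P ≐ Q = P ⊆ Q × Q ⊆ P

≐-refl : {P : A → Bool} → P ≐ P
≐-refl = (λ h → h) , (λ h → h)

count : (A → Bool) → List A → ℕ
count P xs = length (filterᵇ P xs)

module _ {P Q : A → Bool} where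

  count-mono : P ⊆ Q → ∀ xs → count P xs ≤ count Q xs
  count-mono P⊆Q []       = z≤n
  count-mono P⊆Q (x ∷ xs) with P x in px | Q x in qx
  ... | true  | true  = s≤s (count-mono P⊆Q xs)
  ... | true  | false = ⊥-elim (subst T qx (P⊆Q (subst T (sym px) _)))
  ... | false | true  = m≤n⇒m≤1+n (count-mono P⊆Q xs)
  ... | false | false = count-mono P⊆Q xs

  count-∖ : P ⊆ Q → ∀ xs → count P xs + count (Q ∖ P) xs ≡ count Q xs
  count-∖ P⊆Q []       = refl
  count-∖ P⊆Q (x ∷ xs) with P x in px | Q x in qx
  ... | true  | true  = cong suc (count-∖ P⊆Q xs)
  ... | true  | false = ⊥-elim (subst T qx (P⊆Q (subst T (sym px) _)))
  ... | false | true  = trans (+-suc _ _) (cong suc (count-∖ P⊆Q xs))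
  ... | false | false = count-∖ P⊆Q xs

count-++ : ∀ (P : A → Bool) xs ys → count P (xs ++ ys) ≡ count P xs + count P ys
count-++ P xs ys = trans (cong length (filter-++ (T? ∘ P) xs ys)) (length-++ (filterᵇ P xs))

count-map : ∀ (P : B → Bool) (f : A → B) xs → count P (map f xs) ≡ count (λ x → P (f x)) xs
count-map P f []       = refl
count-map P f (x ∷ xs) with P (f x)
... | true  = cong suc (count-map P f xs)
... | false = count-map P f xs

count-none : ∀ (xs : List A) → count (λ _ → false) xs ≡ 0
count-none []       = refl
count-none (_ ∷ xs) = count-none xs

count-⊗ : ∀ (P : A → Bool) (Q : B → Bool) xs ys →
          count (P ⊗ Q) (cartesianProduct xs ys) ≡ count P xs * count Q ys
count-⊗ P Q []       ys = refl
count-⊗ P Q (x ∷ xs) ys = begin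
  count (P ⊗ Q) (map (x ,_) ys ++ cartesianProduct xs ys)
    ≡⟨ count-++ (P ⊗ Q) (map (x ,_) ys) (cartesianProduct xs ys) ⟩
  count (P ⊗ Q) (map (x ,_) ys) + count (P ⊗ Q) (cartesianProduct xs ys)
    ≡⟨ cong₂ _+_ (count-map (P ⊗ Q) (x ,_) ys) (count-⊗ P Q xs ys) ⟩
  count (λ y → P x ∧ Q y) ys + count P xs * count Q ys
    ≡⟨ row ⟩
  count P (x ∷ xs) * count Q ys ∎
  where
  open ≡-Reasoning
  row : count (λ y → P x ∧ Q y) ys + count P xs * count Q ys ≡ count P (x ∷ xs) * count Q ys
  row with P x
  ... | true  = refl
  ... | false = cong (_+ count P xs * count Q ys) (count-none ys)

count-⋉≤ : ∀ (P : A → Bool) (Q : A → B → Bool) M xs ys →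
           (∀ {x} → T (P x) → count (Q x) ys ≤ M) →
           count (P ⋉ Q) (cartesianProduct xs ys) ≤ count P xs * M
count-⋉≤ P Q M []       ys _       = z≤n
count-⋉≤ P Q M (x ∷ xs) ys fibre≤M = begin
  count (P ⋉ Q) (map (x ,_) ys ++ cartesianProduct xs ys)
    ≡⟨ count-++ (P ⋉ Q) (map (x ,_) ys) (cartesianProduct xs ys) ⟩
  count (P ⋉ Q) (map (x ,_) ys) + count (P ⋉ Q) (cartesianProduct xs ys)
    ≤⟨ +-mono-≤ (≤-reflexive (count-map (P ⋉ Q) (x ,_) ys)) (count-⋉≤ P Q M xs ys fibre≤M) ⟩
  count (λ y → P x ∧ Q x y) ys + count P xs * M
    ≤⟨ row ⟩
  count P (x ∷ xs) * M ∎
  where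
  open ≤-Reasoning
  row : count (λ y → P x ∧ Q x y) ys + count P xs * M ≤ count P (x ∷ xs) * M
  row with P x in px
  ... | true  = +-monoˡ-≤ _ (fibre≤M (subst T (sym px) _))
  ... | false = ≤-reflexive (cong (_+ count P xs * M) (count-none ys))

T-not : ∀ b → T (not b) ⇔ (¬ T b)
T-not true  = mk⇔ (λ ()) (λ ¬⊤ → ¬⊤ _)
T-not false = mk⇔ (λ _ ()) (λ _ → _)

record Finite (A : Set) : Set where
  field
    elements          : List A
    elements-unique   : Unique elements
    elements-complete : ∀ x → x ∈ₗ elements

open Finite {{...}} public

instance
  Fin-finite : ∀ {n} → Finite (Fin n)
  Fin-finite = record
    { elements          = allFin _
    ; elements-unique   = Unique.allFin⁺ _
    ; elements-complete = ∈-allFin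
    }

  ×-finite : {{Finite A}} → {{Finite B}} → Finite (A × B)
  ×-finite = record
    { elements          = cartesianProduct elements elements
    ; elements-unique   = Unique.cartesianProduct⁺ elements-unique elements-unique
    ; elements-complete = λ (x , y) → ∈-cartesianProduct⁺ (elements-complete x) (elements-complete y)
    }

size : {{Finite A}} → (A → Bool) → ℕ
size P = count P elements

module _ {{_ : Finite A}} where

  size-mono : {P Q : A → Bool} → P ⊆ Q → size P ≤ size Q
  size-mono {P} {Q} P⊆Q = count-mono {P = P} {Q} P⊆Q elements

  size-cong : {P Q : A → Bool} → P ≐ Q → size P ≡ size Q
  size-cong {P} {Q} (P⊆Q , Q⊆P) = ≤-antisym (size-mono {P = P} P⊆Q) (size-mono {P = Q} Q⊆P)

  size-∅ : {P : A → Bool} → (∀ {x} → ¬ T (P x)) → size P ≡ 0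
  size-∅ {P} P-empty = n≤0⇒n≡0 (subst (size P ≤_) (count-none (elements {A}))
                                  (size-mono {P = P} {λ _ → false} (λ Px → ⊥-elim (P-empty Px))))

  size-∖ : {P Q : A → Bool} → P ⊆ Q → size P + size (Q ∖ P) ≡ size Q
  size-∖ {P} {Q} P⊆Q = count-∖ {P = P} {Q} P⊆Q elements

  ∈-filterᵇ⁻ : ∀ {P : A → Bool} {x} → x ∈ₗ filterᵇ P elements → T (P x)
  ∈-filterᵇ⁻ {P} x∈ = proj₂ (∈-filter⁻ (T? ∘ P) {xs = elements} x∈)

  size-≤-injection : {{_ : Finite B}} {P : A → Bool} {Q : B → Bool} (f : A → B) →
                     Injective _≡_ _≡_ f → (∀ {x} → T (P x) → T (Q (f x))) → size P ≤ size Q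
  size-≤-injection {P = P} {Q} f f-injective P⊆Q∘f = begin
    size P                               ≡⟨ length-map f (filterᵇ P elements) ⟨
    length (map f (filterᵇ P elements))  ≤⟨ Unique-⊆⇒length≤ image-unique image⊆Q ⟩
    size Q                               ∎
    where
    open ≤-Reasoning
    image-unique : Unique (map f (filterᵇ P elements))
    image-unique = Unique.map⁺ f-injective (Unique.filter⁺ (T? ∘ P) elements-unique)
    image⊆Q : map f (filterᵇ P elements) ⊆ₗ filterᵇ Q elements
    image⊆Q y∈ with ∈-map⁻ f y∈
    ... | x , x∈ , refl = ∈-filter⁺ (T? ∘ Q) (elements-complete (f x)) (P⊆Q∘f (∈-filterᵇ⁻ x∈))

  size>0⇒nonempty : {P : A → Bool} → 0 < size P → ∃ λ x → T (P x)
  size>0⇒nonempty {P} = nonempty (filterᵇ P elements) ∈-filterᵇ⁻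
    where
    nonempty : ∀ xs → (∀ {x} → x ∈ₗ xs → T (P x)) → 0 < length xs → ∃ λ x → T (P x)
    nonempty (x ∷ _) xs⊆P _ = x , xs⊆P (here refl)

  size>1⇒distinct : {P : A → Bool} → 1 < size P → ∃₂ λ x y → x ≢ y × T (P x) × T (P y)
  size>1⇒distinct {P} =
    distinct (filterᵇ P elements) (Unique.filter⁺ (T? ∘ P) elements-unique) ∈-filterᵇ⁻
    where
    distinct : ∀ xs → Unique xs → (∀ {x} → x ∈ₗ xs → T (P x)) → 1 < length xs →
               ∃₂ λ x y → x ≢ y × T (P x) × T (P y)
    distinct (x ∷ y ∷ _) ((x≢y ∷ _) ∷ _) xs⊆P (s≤s (s≤s z≤n)) =
      x , y , x≢y , xs⊆P (here refl) , xs⊆P (there (here refl))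

  module _ {{_ : Finite B}} where

    size-⊗ : (P : A → Bool) (Q : B → Bool) → size (P ⊗ Q) ≡ size P * size Q
    size-⊗ P Q = count-⊗ P Q elements elements

    size-⋉≤ : (P : A → Bool) (Q : A → B → Bool) (M : ℕ) →
              (∀ {x} → T (P x) → size (Q x) ≤ M) → size (P ⋉ Q) ≤ size P * M
    size-⋉≤ P Q M = count-⋉≤ P Q M elements elements

first : A → (A → Bool) → List A → A
first d P []       = d
first d P (x ∷ xs) = if P x then x else first d P xs

first-satisfies : ∀ d (P : A → Bool) {xs x} → x ∈ₗ xs → T (P x) → T (P (first d P xs))
first-satisfies d P {y ∷ xs} x∈ Px with P y in py
... | true = subst T (sym py) _
first-satisfies d P {y ∷ xs} (here refl)  Px | false = ⊥-elim (subst T py Px)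
first-satisfies d P {y ∷ xs} (there x∈xs) Px | false = first-satisfies d P x∈xs Px

module _ {I : Set} (num den : I → ℕ) where

  ratio-trans : ∀ i j k → 0 < den j → num i * den j ≤ num j * den i → num j * den k ≤ num k * den j →
                num i * den k ≤ num k * den i
  ratio-trans i j k = cross-mul-trans {num i} {den i} {num j} {den j} {num k} {den k}

  ratio-argmin : ∀ {x} xs → x ∈ₗ xs → All (λ i → 0 < den i) xs →
                 ∃ λ i → i ∈ₗ xs × All (λ j → num i * den j ≤ num j * den i) xs
  ratio-argmin (y ∷ [])          _ _ = y , here refl , ≤-refl ∷ []
  ratio-argmin (y ∷ ys@(_ ∷ _)) _ (_ ∷ 0<ys) with ratio-argmin ys (here refl) 0<ys
  ... | i , i∈ys , i≼ys with num y * den i ≤? num i * den y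
  ...   | yes y≼i =
    y , here refl , ≤-refl ∷ All.map (λ {j} → ratio-trans y i j (All.lookup 0<ys i∈ys) y≼i) i≼ys
  ...   | no  y⋠i = i , there i∈ys , <⇒≤ (≰⇒> y⋠i) ∷ i≼ys

allSubsets : ∀ n → List (Subset n)
allSubsets zero    = [] ∷ []
allSubsets (suc n) = map (true ∷_) (allSubsets n) ++ map (false ∷_) (allSubsets n)

∈-allSubsets : ∀ {n} (p : Subset n) → p ∈ₗ allSubsets n
∈-allSubsets []          = here refl
∈-allSubsets (true ∷ p)  = ∈-++⁺ˡ (∈-map⁺ (true ∷_) (∈-allSubsets p))
∈-allSubsets (false ∷ p) =
  ∈-++⁺ʳ (map (true ∷_) (allSubsets _)) (∈-map⁺ (false ∷_) (∈-allSubsets p))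

ratio-minimiser : ∀ {n} (f : (Fin n → Bool) → ℕ) → (∀ {X Y} → X ≐ Y → f X ≡ f Y) →
                  ∀ {A} → 0 < size A →
                  ∃ λ X → X ⊆ A × 0 < size X × (∀ {Y} → Y ⊆ A → f X * size Y ≤ f Y * size X)
ratio-minimiser {n} f f-cong {A} 0<∣A∣ = X , X⊆A , 0<∣X∣ , minimal
  where
  restrict : Subset n → Fin n → Bool
  restrict p = lookup p ∩ A

  candidates : List (Fin n → Bool)
  candidates = filter (λ Y → 0 <? size Y) (map restrict (allSubsets n))

  restrict-tabulate : ∀ {Y} → Y ⊆ A → restrict (Vec.tabulate Y) ≐ Y
  restrict-tabulate {Y} Y⊆A =
    (λ {x} h → subst T (lookup∘tabulate Y x) (proj₁ (Equivalence.to T-∧ h))) ,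
    (λ {x} h → Equivalence.from T-∧ (subst T (sym (lookup∘tabulate Y x)) h , Y⊆A h))

  candidate : ∀ {Y} → Y ⊆ A → 0 < size Y → restrict (Vec.tabulate Y) ∈ₗ candidates
  candidate {Y} Y⊆A 0<∣Y∣ =
    ∈-filter⁺ (λ Y → 0 <? size Y) (∈-map⁺ restrict (∈-allSubsets (Vec.tabulate Y)))
      (subst (0 <_) (sym (size-cong (restrict-tabulate Y⊆A))) 0<∣Y∣)

  argmin : ∃ λ X → X ∈ₗ candidates × All (λ Y → f X * size Y ≤ f Y * size X) candidates
  argmin = ratio-argmin f size candidates (candidate (λ h → h) 0<∣A∣)
             (all-filter (λ Y → 0 <? size Y) (map restrict (allSubsets n)))

  X : Fin n → Bool
  X = proj₁ argmin

  X-candidate : X ∈ₗ map restrict (allSubsets n) × 0 < size X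
  X-candidate = ∈-filter⁻ (λ Y → 0 <? size Y) {xs = map restrict (allSubsets n)} (proj₁ (proj₂ argmin))

  X⊆A : X ⊆ A
  X⊆A {x} h with ∈-map⁻ restrict (proj₁ X-candidate)
  ... | _ , _ , X≡restrict-p = proj₂ (Equivalence.to T-∧ (subst (λ Z → T (Z x)) X≡restrict-p h))

  0<∣X∣ : 0 < size X
  0<∣X∣ = proj₂ X-candidate

  minimal : ∀ {Y} → Y ⊆ A → f X * size Y ≤ f Y * size X
  minimal {Y} Y⊆A with 0 <? size Y
  ... | yes 0<∣Y∣ = subst₂ (λ a b → f X * a ≤ b * size X) (size-cong Y′≐Y) (f-cong Y′≐Y)
                      (All.lookup (proj₂ (proj₂ argmin)) (candidate Y⊆A 0<∣Y∣))
    where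
    Y′≐Y : restrict (Vec.tabulate Y) ≐ Y
    Y′≐Y = restrict-tabulate Y⊆A
  ... | no  ∣Y∣≯0 rewrite n≤0⇒n≡0 (≮⇒≥ ∣Y∣≯0) | *-zeroʳ (f X) = z≤n

∈⇔T-lookup : ∀ {n} {p : Subset n} {x} → x ∈ p ⇔ T (lookup p x)
∈⇔T-lookup {p = p} {x} =
  mk⇔ (λ x∈p → Equivalence.from T-≡ ([]=⇒lookup x∈p))
      (λ Tpx → lookup⇒[]= x p (Equivalence.to T-≡ Tpx))

count-lookup-∷ : ∀ {n} b (p : Subset n) → count (lookup (b ∷ p)) (tabulate Fin.suc) ≡ size (lookup p)
count-lookup-∷ {n} b p = trans (cong (count (lookup (b ∷ p))) (sym (map-tabulate (λ i → i) Fin.suc)))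
                               (count-map (lookup (b ∷ p)) Fin.suc (allFin n))

size-lookup : ∀ {n} (p : Subset n) → size (lookup p) ≡ ∣ p ∣
size-lookup []          = refl
size-lookup (true ∷ p)  = cong suc (trans (count-lookup-∷ true p) (size-lookup p))
size-lookup (false ∷ p) = trans (count-lookup-∷ false p) (size-lookup p)

module FiniteAbelianGroup {N : ℕ} {op : Op₂ (Fin N)} {e : Fin N} {inv : Op₁ (Fin N)}
                          (isAbelianGroup : IsAbelianGroup _≡_ op e inv) where

  G : AbelianGroup _ _
  G = record { isAbelianGroup = isAbelianGroup }

  open AbelianGroup G public using (_∙_; ε; _⁻¹; _-_)
  open AbelianGroup G
    using (assoc; comm; identityˡ; identityʳ; inverseˡ; inverseʳ;
           rawMonoid; monoid; commutativeMonoid; commutativeSemigroup)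
  open AbelianGroupProperties G
    using (∙-cancelˡ; ∙-cancelʳ; ⁻¹-injective; ⁻¹-involutive; inverseʳ-unique; identityˡ-unique;
           //-rightDividesˡ; //-rightDividesʳ; x∙y⁻¹≈ε⇒x≈y)
  open CommutativeSemigroupProperties commutativeSemigroup using (xy∙z≈xz∙y)
  open RawMonoidDefinitions rawMonoid public using () renaming (_×_ to _·_)
  open MonoidMultProperties monoid using (×-assocˡ)
  open CommutativeMonoidMultProperties commutativeMonoid using (×-distrib-+)
  open CommutativeMonoidSumProperties commutativeMonoid using (sum; ∑-distrib-+; sum-permute; sum-replicate)

  x-y∙y≡x : ∀ x y → (x - y) ∙ y ≡ x
  x-y∙y≡x x y = //-rightDividesˡ y x

  x∙y-y≡x : ∀ x y → (x ∙ y) - y ≡ x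
  x∙y-y≡x x y = //-rightDividesʳ y x

  x-[x-y]≡y : ∀ x y → x - (x - y) ≡ y
  x-[x-y]≡y x y = begin
    x - (x - y)            ≡⟨ cong (_- (x - y)) (trans (sym (x-y∙y≡x x y)) (comm (x - y) y)) ⟩
    (y ∙ (x - y)) - (x - y) ≡⟨ x∙y-y≡x y (x - y) ⟩
    y                      ∎
    where open ≡-Reasoning

  x-y-z∙zy≡x : ∀ x y z → ((x - y) - z) ∙ (z ∙ y) ≡ x
  x-y-z∙zy≡x x y z = begin
    ((x - y) - z) ∙ (z ∙ y)   ≡⟨ assoc ((x - y) - z) z y ⟨
    ((x - y) - z) ∙ z ∙ y     ≡⟨ cong (_∙ y) (x-y∙y≡x (x - y) z) ⟩
    (x - y) ∙ y               ≡⟨ x-y∙y≡x x y ⟩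
    x                         ∎
    where open ≡-Reasoning

  x-y∙z∙y≡x∙z : ∀ x y z → (x - y) ∙ z ∙ y ≡ x ∙ z
  x-y∙z∙y≡x∙z x y z = trans (xy∙z≈xz∙y (x - y) z y) (cong (_∙ z) (x-y∙y≡x x y))

  x∙y∙z-y-z≡x : ∀ x y z → x ∙ y ∙ z - y - z ≡ x
  x∙y∙z-y-z≡x x y z = begin
    x ∙ y ∙ z - y - z  ≡⟨ cong (λ w → w - y - z) (xy∙z≈xz∙y x y z) ⟩
    x ∙ z ∙ y - y - z  ≡⟨ cong (_- z) (x∙y-y≡x (x ∙ z) y) ⟩
    x ∙ z - z          ≡⟨ x∙y-y≡x x z ⟩
    x                  ∎
    where open ≡-Reasoning

  -‿cancelˡ : ∀ x {y z} → x - y ≡ x - z → y ≡ z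
  -‿cancelˡ x eq = ⁻¹-injective (∙-cancelˡ x _ _ eq)

  times≡· : ∀ t y → times _∙_ ε t y ≡ t · y
  times≡· zero    y = refl
  times≡· (suc t) y = cong (y ∙_) (times≡· t y)

  ·-ε : ∀ t → t · ε ≡ ε
  ·-ε zero    = refl
  ·-ε (suc t) = trans (identityˡ _) (·-ε t)

  ·-⁻¹ : ∀ t y → t · (y ⁻¹) ≡ (t · y) ⁻¹
  ·-⁻¹ t y = inverseʳ-unique (t · y) (t · (y ⁻¹)) (begin
    t · y ∙ t · (y ⁻¹)  ≡⟨ ×-distrib-+ y (y ⁻¹) t ⟨
    t · (y ∙ y ⁻¹)      ≡⟨ cong (t ·_) (inverseʳ y) ⟩
    t · ε               ≡⟨ ·-ε t ⟩
    ε                   ∎)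
    where open ≡-Reasoning

  ·-comm : ∀ s t y → s · (t · y) ≡ t · (s · y)
  ·-comm s t y = trans (×-assocˡ y s t) (trans (cong (_· y) (*-comm s t)) (sym (×-assocˡ y t s)))

  N·y≡ε : ∀ y → N · y ≡ ε
  N·y≡ε y = identityˡ-unique (N · y) (sum (λ i → i)) (begin
    N · y ∙ sum (λ i → i)             ≡⟨ cong (_∙ sum (λ i → i)) (sum-replicate N {y}) ⟨
    sum (λ (_ : Fin N) → y) ∙ sum (λ i → i) ≡⟨ ∑-distrib-+ (λ _ → y) (λ i → i) ⟨
    sum (λ i → y ∙ i)                 ≡⟨ sum-permute (λ i → i) translation ⟨
    sum (λ i → i)                     ∎)
    where
    open ≡-Reasoning
    translation : Permutation N N
    translation = permutation (y ∙_) (y ⁻¹ ∙_)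
      (λ x → trans (sym (assoc _ _ _)) (trans (cong (_∙ x) (inverseʳ y)) (identityˡ x)))
      (λ x → trans (sym (assoc _ _ _)) (trans (cong (_∙ x) (inverseˡ y)) (identityˡ x)))

  multiple-of-N·y≡ε : ∀ k y → (k * N) · y ≡ ε
  multiple-of-N·y≡ε k y = trans (sym (×-assocˡ y k N)) (trans (cong (k ·_) (N·y≡ε y)) (·-ε k))

  ·-invertible : ∀ {t} → Coprime t N → ∃ λ g → (∀ y → g (t · y) ≡ y) × (∀ y → t · g y ≡ y)
  ·-invertible {t} t⊥N with coprime-Bézout t⊥N
  ... | Bézout.+- u v 1+vN≡ut = (u ·_) , u·t·y≡y , λ y → trans (·-comm t u y) (u·t·y≡y y)
    where
    u·t·y≡y : ∀ y → u · (t · y) ≡ y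
    u·t·y≡y y = begin
      u · (t · y)      ≡⟨ ×-assocˡ y u t ⟩
      (u * t) · y      ≡⟨ cong (_· y) 1+vN≡ut ⟨
      (1 + v * N) · y  ≡⟨ cong (y ∙_) (multiple-of-N·y≡ε v y) ⟩
      y ∙ ε            ≡⟨ identityʳ y ⟩
      y                ∎
      where open ≡-Reasoning
  ... | Bézout.-+ u v 1+ut≡vN = (λ y → (u · y) ⁻¹) , [u·t·y]⁻¹≡y ,
      λ y → trans (·-⁻¹ t (u · y)) (trans (cong _⁻¹ (·-comm t u y)) ([u·t·y]⁻¹≡y y))
    where
    [u·t·y]⁻¹≡y : ∀ y → (u · (t · y)) ⁻¹ ≡ y
    [u·t·y]⁻¹≡y y = begin
      (u · (t · y)) ⁻¹  ≡⟨ cong _⁻¹ (×-assocˡ y u t) ⟩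
      ((u * t) · y) ⁻¹  ≡⟨ cong _⁻¹ (inverseʳ-unique y _ y∙ut·y≡ε) ⟩
      y ⁻¹ ⁻¹           ≡⟨ ⁻¹-involutive y ⟩
      y                 ∎
      where
      open ≡-Reasoning
      y∙ut·y≡ε : y ∙ (u * t) · y ≡ ε
      y∙ut·y≡ε = trans (cong (_· y) 1+ut≡vN) (multiple-of-N·y≡ε v y)

  -- Sumsets and difference sets

  -- X ⊟ Y is the difference set X − Y and X ⊞ Y the sumset X + Y; sumset h A is hA.
  infixl 6 _⊟_ _⊞_

  _⊟_ _⊞_ : (X Y : Fin N → Bool) → Fin N → Bool
  (X ⊟ Y) z = any (λ y → Y y ∧ X (z ∙ y)) elements
  (X ⊞ Y) z = any (λ y → Y y ∧ X (z - y)) elements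

  any-intro : ∀ (p : Fin N → Bool) y → T (p y) → T (any p elements)
  any-intro p y py = any⁺ p (Any.map (λ { refl → py }) (elements-complete y))

  any-elim : ∀ (p : Fin N → Bool) → T (any p elements) → ∃ λ y → T (p y)
  any-elim p h = satisfied (any⁻ p elements h)

  module _ {X Y : Fin N → Bool} where

    ⊟-intro : ∀ {z} y → T (Y y) → T (X (z ∙ y)) → T ((X ⊟ Y) z)
    ⊟-intro {z} y Yy Xzy = any-intro (λ y → Y y ∧ X (z ∙ y)) y (Equivalence.from T-∧ (Yy , Xzy))

    ⊟-elim : ∀ {z} → T ((X ⊟ Y) z) → ∃ λ y → T (Y y) × T (X (z ∙ y))
    ⊟-elim {z} h with any-elim (λ y → Y y ∧ X (z ∙ y)) h
    ... | y , h′ = y , Equivalence.to T-∧ h′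

    ⊟⁺ : ∀ {x y} → T (X x) → T (Y y) → T ((X ⊟ Y) (x - y))
    ⊟⁺ {x} {y} Xx Yy = ⊟-intro y Yy (subst (T ∘ X) (sym (x-y∙y≡x x y)) Xx)

    ⊞-intro : ∀ {z} y → T (Y y) → T (X (z - y)) → T ((X ⊞ Y) z)
    ⊞-intro {z} y Yy Xz-y = any-intro (λ y → Y y ∧ X (z - y)) y (Equivalence.from T-∧ (Yy , Xz-y))

    ⊞-elim : ∀ {z} → T ((X ⊞ Y) z) → ∃ λ y → T (Y y) × T (X (z - y))
    ⊞-elim {z} h with any-elim (λ y → Y y ∧ X (z - y)) h
    ... | y , h′ = y , Equivalence.to T-∧ h′

    ⊞⁺ : ∀ {x y} → T (X x) → T (Y y) → T ((X ⊞ Y) (x ∙ y))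
    ⊞⁺ {x} {y} Xx Yy = ⊞-intro y Yy (subst (T ∘ X) (sym (x∙y-y≡x x y)) Xx)

  ⊟-mono : ∀ {X X′ Y Y′} → X ⊆ X′ → Y ⊆ Y′ → X ⊟ Y ⊆ X′ ⊟ Y′
  ⊟-mono {X} {X′} {Y} {Y′} X⊆X′ Y⊆Y′ h with ⊟-elim {X} {Y} h
  ... | y , Yy , Xzy = ⊟-intro {X′} {Y′} y (Y⊆Y′ Yy) (X⊆X′ Xzy)

  ⊟-cong : ∀ {X X′ Y Y′} → X ≐ X′ → Y ≐ Y′ → X ⊟ Y ≐ X′ ⊟ Y′
  ⊟-cong {X} {X′} {Y} {Y′} (X⊆X′ , X′⊆X) (Y⊆Y′ , Y′⊆Y) =
    ⊟-mono {X} {X′} {Y} {Y′} X⊆X′ Y⊆Y′ , ⊟-mono {X′} {X} {Y′} {Y} X′⊆X Y′⊆Y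

  ⊟-⊟ : ∀ X U V → (X ⊟ U) ⊟ V ≐ X ⊟ (U ⊞ V)
  ⊟-⊟ X U V = to , from
    where
    to : (X ⊟ U) ⊟ V ⊆ X ⊟ (U ⊞ V)
    to {z} h with ⊟-elim {X ⊟ U} {V} h
    ... | v , Vv , h′ with ⊟-elim {X} {U} h′
    ... | u , Uu , Xzvu = ⊟-intro {X} {U ⊞ V} (u ∙ v) (⊞⁺ {U} {V} Uu Vv)
                            (subst (T ∘ X) (trans (xy∙z≈xz∙y z v u) (assoc z u v)) Xzvu)
    from : X ⊟ (U ⊞ V) ⊆ (X ⊟ U) ⊟ V
    from {z} h with ⊟-elim {X} {U ⊞ V} h
    ... | w , U⊞Vw , Xzw with ⊞-elim {U} {V} U⊞Vw
    ... | v , Vv , Uw-v = ⊟-intro {X ⊟ U} {V} v Vv (⊟-intro {X} {U} (w - v) Uw-v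
                            (subst (T ∘ X) (sym zv∙[w-v]≡zw) Xzw))
      where
      zv∙[w-v]≡zw : (z ∙ v) ∙ (w - v) ≡ z ∙ w
      zv∙[w-v]≡zw = trans (assoc z v (w - v)) (cong (z ∙_) (trans (comm v (w - v)) (x-y∙y≡x w v)))

  sumset : ℕ → (Fin N → Bool) → Fin N → Bool
  sumset zero    A z = ⌊ z ≟ ε ⌋
  sumset (suc h) A   = A ⊞ sumset h A

  ·-∈-sumset : ∀ {A a} h → T (A a) → T (sumset h A (h · a))
  ·-∈-sumset zero    Aa = fromWitness refl
  ·-∈-sumset {A} (suc h) Aa = ⊞⁺ {A} {sumset h A} Aa (·-∈-sumset h Aa)

  ⊟-sumset-zero : ∀ X A → X ⊟ sumset 0 A ≐ X
  ⊟-sumset-zero X A = to , from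
    where
    to : X ⊟ sumset 0 A ⊆ X
    to {z} h with ⊟-elim {X} {sumset 0 A} h
    ... | y , y≟ε , Xzy = subst (T ∘ X) (trans (cong (z ∙_) (toWitness y≟ε)) (identityʳ z)) Xzy
    from : X ⊆ X ⊟ sumset 0 A
    from {z} Xz = ⊟-intro {X} {sumset 0 A} ε (fromWitness refl) (subst (T ∘ X) (sym (identityʳ z)) Xz)

  -- Ruzsa, Petridis and Plünnecke

  ruzsa-triangle : ∀ X U V → size X * size (U ⊟ V) ≤ size (X ⊟ U) * size (X ⊟ V)
  ruzsa-triangle X U V = begin
    size X * size (U ⊟ V)         ≡⟨ size-⊗ X (U ⊟ V) ⟨
    size (X ⊗ (U ⊟ V))            ≤⟨ size-≤-injection embed embed-injective embed-maps ⟩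
    size ((X ⊟ U) ⊗ (X ⊟ V))      ≡⟨ size-⊗ (X ⊟ U) (X ⊟ V) ⟩
    size (X ⊟ U) * size (X ⊟ V)   ∎
    where
    open ≤-Reasoning
    chosen : Fin N → Fin N → Bool
    chosen z v = V v ∧ U (z ∙ v)

    v : Fin N → Fin N
    v z = first ε (chosen z) elements

    chosen-v : ∀ {z} → T ((U ⊟ V) z) → T (V (v z)) × T (U (z ∙ v z))
    chosen-v {z} h with ⊟-elim {U} {V} h
    ... | y , Vy , Uzy = Equivalence.to T-∧ (first-satisfies ε (chosen z) (elements-complete y)
                                              (Equivalence.from T-∧ (Vy , Uzy)))

    -- The second coordinate minus the first is z, and then x is recovered from the second one.
    embed : Fin N × Fin N → Fin N × Fin N
    embed (x , z) = (x - v z) - z , x - v z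

    embed-injective : Injective _≡_ _≡_ embed
    embed-injective {x , z} {x′ , z′} eq with cong proj₂ eq
    ... | x-vz≡x′-vz′
      with -‿cancelˡ (x - v z) (trans (cong proj₁ eq) (cong (_- z′) (sym x-vz≡x′-vz′)))
    ... | refl = cong (_, z) (∙-cancelʳ (v z ⁻¹) x x′ x-vz≡x′-vz′)

    embed-maps : ∀ {p} → T ((X ⊗ (U ⊟ V)) p) → T (((X ⊟ U) ⊗ (X ⊟ V)) (embed p))
    embed-maps {x , z} h with Equivalence.to T-∧ h
    ... | Xx , [U⊟V]z with chosen-v [U⊟V]z
    ... | Vvz , Uzvz = Equivalence.from T-∧
      ( ⊟-intro {X} {U} (z ∙ v z) Uzvz (subst (T ∘ X) (sym (x-y-z∙zy≡x x (v z) z)) Xx)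
      , ⊟-intro {X} {V} (v z) Vvz (subst (T ∘ X) (sym (x-y∙y≡x x (v z))) Xx))

  popular-translate : ∀ S W → ∃ λ s → size S * size W ≤ size (S ⊟ W) * size (S ∩ W ∘ (_- s))
  popular-translate S W = s , (begin
    size S * size W              ≡⟨ size-⊗ S W ⟨
    size (S ⊗ W)                 ≤⟨ size-≤-injection embed embed-injective embed-maps ⟩
    size ((S ⊟ W) ⋉ shared)     ≤⟨ size-⋉≤ (S ⊟ W) shared _ (λ {s′} _ → shared-max s′) ⟩
    size (S ⊟ W) * size (shared s) ∎)
    where
    open ≤-Reasoning
    shared : Fin N → Fin N → Bool
    shared s = S ∩ W ∘ (_- s)

    s : Fin N
    s = argmax (size ∘ shared) ε elements

    shared-max : ∀ s′ → size (shared s′) ≤ size (shared s)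
    shared-max s′ = All.lookup (f[xs]≤f[argmax] {f = size ∘ shared} ε elements) (elements-complete s′)

    embed : Fin N × Fin N → Fin N × Fin N
    embed (u , w) = u - w , u

    embed-injective : Injective _≡_ _≡_ embed
    embed-injective {u , w} {u′ , w′} eq with cong proj₂ eq
    ... | refl = cong (u ,_) (-‿cancelˡ u (cong proj₁ eq))

    embed-maps : ∀ {p} → T ((S ⊗ W) p) → T (((S ⊟ W) ⋉ shared) (embed p))
    embed-maps {u , w} h with Equivalence.to T-∧ h
    ... | Su , Ww = Equivalence.from T-∧
      (⊟⁺ {S} {W} Su Ww , Equivalence.from T-∧ (Su , subst (T ∘ W) (sym (x-[x-y]≡y u w)) Ww))

  fromList : List (Fin N) → Fin N → Bool
  fromList cs z = any (λ c → ⌊ z ≟ c ⌋) cs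

  fromList-head : ∀ c cs → T (fromList (c ∷ cs) c)
  fromList-head c cs = Equivalence.from (T-∨ {⌊ c ≟ c ⌋}) (inj₁ (fromWitness refl))

  fromList-tail : ∀ c cs → fromList cs ⊆ fromList (c ∷ cs)
  fromList-tail c cs {z} h = Equivalence.from (T-∨ {⌊ z ≟ c ⌋}) (inj₂ h)

  fromList-∷⁻ : ∀ c cs {z} → T (fromList (c ∷ cs) z) → z ≡ c ⊎ T (fromList cs z)
  fromList-∷⁻ c cs {z} h with Equivalence.to (T-∨ {⌊ z ≟ c ⌋}) h
  ... | inj₁ z≟c = inj₁ (toWitness z≟c)
  ... | inj₂ h′  = inj₂ h′

  fromList-filter : ∀ C → fromList (filterᵇ C elements) ≐ C
  fromList-filter C = to , from
    where
    to : fromList (filterᵇ C elements) ⊆ C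
    to {z} h with find (any⁻ _ (filterᵇ C elements) h)
    ... | c , c∈ , z≟c = subst (T ∘ C) (sym (toWitness z≟c)) (∈-filterᵇ⁻ c∈)
    from : C ⊆ fromList (filterᵇ C elements)
    from {z} Cz =
      any⁺ _ (Any.map (λ { refl → fromWitness refl }) (∈-filter⁺ (T? ∘ C) (elements-complete z) Cz))

  size-⊟-[] : ∀ X → size (X ⊟ fromList []) ≡ 0
  size-⊟-[] X = size-∅ {P = X ⊟ fromList []} λ {z} h →
    case ⊟-elim {X} {fromList []} {z} h of λ { (_ , () , _) }

  module Petridis {A X : Fin N → Bool}
    (minimal : ∀ {Y} → Y ⊆ X → size (X ⊟ A) * size Y ≤ size (Y ⊟ A) * size X) where

    module Extension (c : Fin N) (cs : List (Fin N)) where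

      P C C′ Y Z : Fin N → Bool
      P  = X ⊟ A
      C  = fromList cs
      C′ = fromList (c ∷ cs)
      -- Y = {y ∈ X : y − c − A ⊆ P − C}
      Y  = X ∖ ((not ∘ (P ⊟ C)) ⊞ A) ∘ (_- c)
      Z  = X ∩ (X ⊟ C) ∘ (_- c)

      Y⊆X : Y ⊆ X
      Y⊆X h = proj₁ (Equivalence.to T-∧ h)

      Y⊟A⊆P : Y ⊟ A ⊆ P
      Y⊟A⊆P = ⊟-mono {Y} {X} {A} {A} Y⊆X (λ h → h)

      P⊟C⊆P⊟C′ : P ⊟ C ⊆ P ⊟ C′
      P⊟C⊆P⊟C′ = ⊟-mono {P} {P} {C} {C′} (λ h → h) (fromList-tail c cs)

      X⊟C⊆X⊟C′ : X ⊟ C ⊆ X ⊟ C′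
      X⊟C⊆X⊟C′ = ⊟-mono {X} {X} {C} {C′} (λ h → h) (fromList-tail c cs)

      Y-spec : ∀ {y a} → T (Y y) → T (A a) → T ((P ⊟ C) (y - c - a))
      Y-spec {y} {a} Yy Aa = decidable-stable (T? _) λ ¬[P⊟C] →
        Equivalence.to (T-not _) (proj₂ (Equivalence.to T-∧ Yy))
          (⊞-intro {not ∘ (P ⊟ C)} {A} a Aa (Equivalence.from (T-not _) ¬[P⊟C]))

      Z⊆Y : Z ⊆ Y
      Z⊆Y {z} h with Equivalence.to T-∧ h
      ... | Xz , [X⊟C]z-c with ⊟-elim {X} {C} [X⊟C]z-c
      ... | c₁ , Cc₁ , Xz-c∙c₁ = Equivalence.from T-∧ (Xz , Equivalence.from (T-not _) ¬bad)
        where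
        ¬bad : ¬ T (((not ∘ (P ⊟ C)) ⊞ A) (z - c))
        ¬bad bad with ⊞-elim {not ∘ (P ⊟ C)} {A} bad
        ... | a , Aa , ¬[P⊟C] = Equivalence.to (T-not _) ¬[P⊟C]
          (⊟-intro {P} {C} c₁ Cc₁ (⊟-intro {X} {A} a Aa
            (subst (T ∘ X) (sym (x-y∙z∙y≡x∙z (z - c) a c₁)) Xz-c∙c₁)))

      lost : (P ⊟ C′) ∖ (P ⊟ C) ⊆ (P ∖ (Y ⊟ A)) ∘ (_∙ c)
      lost {w} h with Equivalence.to T-∧ h
      ... | [P⊟C′]w , ¬[P⊟C]w with ⊟-elim {P} {C′} [P⊟C′]w
      ... | c′ , C′c′ , Pwc′ with fromList-∷⁻ c cs C′c′
      ... | inj₂ Cc′  = ⊥-elim (Equivalence.to (T-not _) ¬[P⊟C]w (⊟-intro {P} {C} c′ Cc′ Pwc′))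
      ... | inj₁ refl = Equivalence.from T-∧ (Pwc′ , Equivalence.from (T-not _) ¬[Y⊟A]wc)
        where
        ¬[Y⊟A]wc : ¬ T ((Y ⊟ A) (w ∙ c))
        ¬[Y⊟A]wc h′ with ⊟-elim {Y} {A} h′
        ... | a , Aa , Ywca = Equivalence.to (T-not _) ¬[P⊟C]w
          (subst (T ∘ (P ⊟ C)) (x∙y∙z-y-z≡x w c a) (Y-spec Ywca Aa))

      gained : X ∖ Z ⊆ ((X ⊟ C′) ∖ (X ⊟ C)) ∘ (_- c)
      gained {x} h with Equivalence.to T-∧ h
      ... | Xx , ¬Zx = Equivalence.from T-∧
        ( ⊟-intro {X} {C′} c (fromList-head c cs) (subst (T ∘ X) (sym (x-y∙y≡x x c)) Xx)
        , Equivalence.from (T-not _) λ [X⊟C]x-c →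
            Equivalence.to (T-not _) ¬Zx (Equivalence.from T-∧ (Xx , [X⊟C]x-c)))

      lost-size : size (P ⊟ C′) + size (Y ⊟ A) ≤ size (P ⊟ C) + size P
      lost-size = begin
        size (P ⊟ C′) + size (Y ⊟ A)
          ≡⟨ cong (_+ size (Y ⊟ A)) (size-∖ {P = P ⊟ C} {P ⊟ C′} P⊟C⊆P⊟C′) ⟨
        size (P ⊟ C) + size ((P ⊟ C′) ∖ (P ⊟ C)) + size (Y ⊟ A)
          ≤⟨ +-monoˡ-≤ (size (Y ⊟ A)) (+-monoʳ-≤ (size (P ⊟ C))
               (size-≤-injection (_∙ c) (λ {u} {v} → ∙-cancelʳ c u v) lost)) ⟩
        size (P ⊟ C) + size (P ∖ (Y ⊟ A)) + size (Y ⊟ A)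
          ≡⟨ +-xy∙z≈x∙zy (size (P ⊟ C)) (size (P ∖ (Y ⊟ A))) (size (Y ⊟ A)) ⟩
        size (P ⊟ C) + (size (Y ⊟ A) + size (P ∖ (Y ⊟ A)))
          ≡⟨ cong (size (P ⊟ C) +_) (size-∖ {P = Y ⊟ A} {P} Y⊟A⊆P) ⟩
        size (P ⊟ C) + size P ∎
        where open ≤-Reasoning

      gained-size : size (X ⊟ C) + size X ≤ size (X ⊟ C′) + size Y
      gained-size = begin
        size (X ⊟ C) + size X
          ≡⟨ cong (size (X ⊟ C) +_) (size-∖ {P = Z} {X} (λ h → proj₁ (Equivalence.to T-∧ h))) ⟨
        size (X ⊟ C) + (size Z + size (X ∖ Z))
          ≤⟨ +-monoʳ-≤ (size (X ⊟ C)) (+-mono-≤ (size-mono {P = Z} {Y} Z⊆Y)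
               (size-≤-injection (_- c) (λ {u} {v} → ∙-cancelʳ (c ⁻¹) u v) gained)) ⟩
        size (X ⊟ C) + (size Y + size ((X ⊟ C′) ∖ (X ⊟ C)))
          ≡⟨ +-x∙yz≈xz∙y (size (X ⊟ C)) (size Y) (size ((X ⊟ C′) ∖ (X ⊟ C))) ⟩
        size (X ⊟ C) + size ((X ⊟ C′) ∖ (X ⊟ C)) + size Y
          ≡⟨ cong (_+ size Y) (size-∖ {P = X ⊟ C} {X ⊟ C′} X⊟C⊆X⊟C′) ⟩
        size (X ⊟ C′) + size Y ∎
        where open ≤-Reasoning

    petridis-step : ∀ c cs →
      size X * size ((X ⊟ A) ⊟ fromList cs) ≤ size (X ⊟ A) * size (X ⊟ fromList cs) →
      size X * size ((X ⊟ A) ⊟ fromList (c ∷ cs)) ≤ size (X ⊟ A) * size (X ⊟ fromList (c ∷ cs))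
    petridis-step c cs ih =
      petridis-inequality {size X} {size P} {size (P ⊟ C)} {size (P ⊟ C′)} {size (X ⊟ C)} {size (X ⊟ C′)}
                          {size Y} {size (Y ⊟ A)} lost-size gained-size ih (minimal {Y} Y⊆X)
      where open Extension c cs

    petridis-list : ∀ cs → size X * size ((X ⊟ A) ⊟ fromList cs) ≤ size (X ⊟ A) * size (X ⊟ fromList cs)
    petridis-list []       = ≤-trans (≤-reflexive (trans (cong (size X *_) (size-⊟-[] (X ⊟ A)))
                                                          (*-zeroʳ (size X)))) z≤n
    petridis-list (c ∷ cs) = petridis-step c cs (petridis-list cs)

    petridis : ∀ C → size X * size ((X ⊟ A) ⊟ C) ≤ size (X ⊟ A) * size (X ⊟ C)
    petridis C = subst₂ (λ a b → size X * a ≤ size (X ⊟ A) * b)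
      (size-cong (⊟-cong {X ⊟ A} {X ⊟ A} ≐-refl (fromList-filter C)))
      (size-cong (⊟-cong {X} {X} ≐-refl (fromList-filter C)))
      (petridis-list (filterᵇ C elements))

    petridis-iterated : ∀ h → size X ^ h * size (X ⊟ sumset h A) ≤ size (X ⊟ A) ^ h * size X
    petridis-iterated zero    = +-monoˡ-≤ 0 (size-mono {P = X ⊟ sumset 0 A} {X} (proj₁ (⊟-sumset-zero X A)))
    petridis-iterated (suc h) = begin
      x * x ^ h * size (X ⊟ (A ⊞ sumset h A))
        ≡⟨ cong (x * x ^ h *_) (size-cong (⊟-⊟ X A (sumset h A))) ⟨
      x * x ^ h * size (P ⊟ sumset h A)        ≡⟨ *-xy∙z≈y∙xz x (x ^ h) _ ⟩
      x ^ h * (x * size (P ⊟ sumset h A))      ≤⟨ *-monoʳ-≤ (x ^ h) (petridis (sumset h A)) ⟩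
      x ^ h * (k * size (X ⊟ sumset h A))      ≡⟨ *-x∙yz≈y∙xz (x ^ h) k _ ⟩
      k * (x ^ h * size (X ⊟ sumset h A))      ≤⟨ *-monoʳ-≤ k (petridis-iterated h) ⟩
      k * (k ^ h * x)                          ≡⟨ *-assoc k (k ^ h) x ⟨
      k * k ^ h * x                            ∎
      where
      open ≤-Reasoning
      P : Fin N → Bool
      P = X ⊟ A
      x k : ℕ
      x = size X
      k = size P

    difference-of-sumsets : 0 < size X → ∀ h l →
      size X ^ (h + l) * size (sumset h A ⊟ sumset l A) ≤ size (X ⊟ A) ^ (h + l) * size X
    difference-of-sumsets 0<x h l = *-cancelˡ-≤ x {{>-nonZero 0<x}} (begin
      x * (x ^ (h + l) * L)                 ≡⟨ cong (λ i → x * (i * L)) (^-distribˡ-+-* x h l) ⟩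
      x * (x ^ h * x ^ l * L)               ≡⟨ *-x∙yz≈y∙xz x (x ^ h * x ^ l) L ⟩
      x ^ h * x ^ l * (x * L)               ≤⟨ *-monoʳ-≤ (x ^ h * x ^ l) (ruzsa-triangle X hA lA) ⟩
      x ^ h * x ^ l * (Dₕ * Dₗ)             ≡⟨ *-interchange (x ^ h) (x ^ l) Dₕ Dₗ ⟩
      x ^ h * Dₕ * (x ^ l * Dₗ)             ≤⟨ *-mono-≤ (petridis-iterated h) (petridis-iterated l) ⟩
      k ^ h * x * (k ^ l * x)               ≡⟨ *-interchange (k ^ h) x (k ^ l) x ⟩
      k ^ h * k ^ l * (x * x)               ≡⟨ cong (_* (x * x)) (^-distribˡ-+-* k h l) ⟨
      k ^ (h + l) * (x * x)                 ≡⟨ *-x∙yz≈y∙xz (k ^ (h + l)) x x ⟩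
      x * (k ^ (h + l) * x)                 ∎)
      where
      open ≤-Reasoning
      hA lA : Fin N → Bool
      hA = sumset h A
      lA = sumset l A
      x k L Dₕ Dₗ : ℕ
      x  = size X
      k  = size (X ⊟ A)
      L  = size (hA ⊟ lA)
      Dₕ = size (X ⊟ hA)
      Dₗ = size (X ⊟ lA)

  plünnecke : ∀ {A} → 0 < size A → ∀ h l →
    size A ^ (h + l) * size (sumset h A ⊟ sumset l A) ≤ size (A ⊟ A) ^ (h + l) * size A
  plünnecke {A} 0<∣A∣ h l
    with ratio-minimiser (λ Y → size (Y ⊟ A)) (λ {Y} {Y′} Y≐Y′ → size-cong (⊟-cong {Y} {Y′} Y≐Y′ ≐-refl))
                         0<∣A∣
  ... | X , X⊆A , 0<∣X∣ , minimal =
    rescale-ratio (h + l) 0<∣X∣ (size-mono {P = X} {A} X⊆A) (minimal (λ h → h))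
      (Petridis.difference-of-sumsets {A} {X} (λ Y⊆X → minimal (X⊆A ∘ Y⊆X)) 0<∣X∣ h l)

  -- Dilates

  ·-injective : ∀ {t} → Coprime t N → Injective _≡_ _≡_ (t ·_)
  ·-injective t⊥N {x} {y} eq with ·-invertible t⊥N
  ... | g , g∘t·≗id , _ = trans (sym (g∘t·≗id x)) (trans (cong g eq) (g∘t·≗id y))

  size≤size-preimage-· : ∀ {t} → Coprime t N → ∀ A → size A ≤ size (A ∘ (t ·_))
  size≤size-preimage-· {t} t⊥N A with ·-invertible t⊥N
  ... | g , _ , t·∘g≗id =
    size-≤-injection g g-injective (λ {a} Aa → subst (T ∘ A) (sym (t·∘g≗id a)) Aa)
    where
    g-injective : Injective _≡_ _≡_ g
    g-injective {a} {b} eq = trans (sym (t·∘g≗id a)) (trans (cong (t ·_) eq) (t·∘g≗id b))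

  size≤size-difference : ∀ {A} → 0 < size A → size A ≤ size (A ⊟ A)
  size≤size-difference {A} 0<∣A∣ with size>0⇒nonempty {P = A} 0<∣A∣
  ... | a₀ , Aa₀ =
    size-≤-injection (_- a₀) (λ {u} {v} → ∙-cancelʳ (a₀ ⁻¹) u v) (λ Aa → ⊟⁺ {A} {A} Aa Aa₀)

  ⊟-preimage-· : ∀ t A → A ∘ (t ·_) ⊟ A ∘ (t ·_) ⊆ (A ⊟ A) ∘ (t ·_)
  ⊟-preimage-· t A {y} h with ⊟-elim {A ∘ (t ·_)} {A ∘ (t ·_)} h
  ... | w , At·w , At·[y∙w] = ⊟-intro {A} {A} (t · w) At·w (subst (T ∘ A) (×-distrib-+ y w t) At·[y∙w])

  size-difference-of-preimages : ∀ {t r} → Coprime t N → Coprime r N → ∀ A →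
    size (A ∘ (t ·_) ⊟ A ∘ (r ·_)) ≤ size (sumset r A ⊟ sumset t A)
  size-difference-of-preimages {t} {r} t⊥N r⊥N A =
    size-≤-injection (λ y → r · (t · y)) (·-injective t⊥N ∘ ·-injective r⊥N) maps
    where
    maps : ∀ {y} → T ((A ∘ (t ·_) ⊟ A ∘ (r ·_)) y) → T ((sumset r A ⊟ sumset t A) (r · (t · y)))
    maps {y} h with ⊟-elim {A ∘ (t ·_)} {A ∘ (r ·_)} h
    ... | w , Ar·w , At·[y∙w] = ⊟-intro {sumset r A} {sumset t A} (t · (r · w)) (·-∈-sumset t Ar·w)
          (subst (T ∘ sumset r A) (sym rt·y∙tr·w≡rt·[y∙w]) (·-∈-sumset r At·[y∙w]))
      where
      rt·y∙tr·w≡rt·[y∙w] : r · (t · y) ∙ t · (r · w) ≡ r · (t · (y ∙ w))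
      rt·y∙tr·w≡rt·[y∙w] = begin
        r · (t · y) ∙ t · (r · w)   ≡⟨ cong (r · (t · y) ∙_) (·-comm t r w) ⟩
        r · (t · y) ∙ r · (t · w)   ≡⟨ ×-distrib-+ (t · y) (t · w) r ⟨
        r · (t · y ∙ t · w)         ≡⟨ cong (r ·_) (×-distrib-+ y w t) ⟨
        r · (t · (y ∙ w))           ∎
        where open ≡-Reasoning

  Admissible : ℕ → ℕ → Set
  Admissible m t = t < m × Coprime t N

  module _ {A : Fin N → Bool} {m : ℕ} (0<∣A∣ : 0 < size A) where

    private
      n d E : ℕ
      n = size A
      d = size (A ⊟ A)
      E = m + m

    difference-of-preimages-bound : ∀ {t r} → Admissible m t → Admissible m r →
      n ^ E * size (A ∘ (t ·_) ⊟ A ∘ (r ·_)) ≤ d ^ E * n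
    difference-of-preimages-bound {t} {r} (t<m , t⊥N) (r<m , r⊥N) =
      raise-exponent (size≤size-difference 0<∣A∣) (+-mono-≤ (<⇒≤ r<m) (<⇒≤ t<m))
        (≤-trans (*-monoʳ-≤ (n ^ (r + t)) (size-difference-of-preimages t⊥N r⊥N A))
                 (plünnecke 0<∣A∣ r t))

    Refinement : (Fin N → Bool) → ℕ → Set
    Refinement S r = ∃ λ S′ → S′ ⊆ S
                            × S′ ⊟ S′ ⊆ A ∘ (r ·_) ⊟ A ∘ (r ·_)
                            × n ^ E * size S ≤ d ^ E * size S′

    refine : ∀ {S t r} → Admissible m t → Admissible m r → S ⊆ A ∘ (t ·_) → Refinement S r
    refine {S} {t} {r} t-ok r-ok@(_ , r⊥N) S⊆Wₜ with popular-translate S (A ∘ (r ·_))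
    ... | s , popular = S′ , proj₁ ∘ Equivalence.to T-∧ , S′⊟S′⊆Wᵣ⊟Wᵣ ,
      *-cancelʳ-≤ (n ^ E * size S) (d ^ E * size S′) n {{>-nonZero 0<∣A∣}} (begin
        n ^ E * size S * n                     ≤⟨ *-monoʳ-≤ (n ^ E * size S) (size≤size-preimage-· r⊥N A) ⟩
        n ^ E * size S * size Wᵣ               ≡⟨ *-assoc (n ^ E) (size S) (size Wᵣ) ⟩
        n ^ E * (size S * size Wᵣ)             ≤⟨ *-monoʳ-≤ (n ^ E) popular ⟩
        n ^ E * (size (S ⊟ Wᵣ) * size S′)      ≤⟨ *-monoʳ-≤ (n ^ E) (*-monoˡ-≤ (size S′) ∣S⊟Wᵣ∣≤∣Wₜ⊟Wᵣ∣) ⟩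
        n ^ E * (size (Wₜ ⊟ Wᵣ) * size S′)     ≡⟨ *-assoc (n ^ E) (size (Wₜ ⊟ Wᵣ)) (size S′) ⟨
        n ^ E * size (Wₜ ⊟ Wᵣ) * size S′       ≤⟨ *-monoˡ-≤ (size S′) (difference-of-preimages-bound t-ok r-ok) ⟩
        d ^ E * n * size S′                    ≡⟨ *-xy∙z≈xz∙y (d ^ E) n (size S′) ⟩
        d ^ E * size S′ * n                    ∎)
      where
      open ≤-Reasoning
      Wₜ Wᵣ S′ : Fin N → Bool
      Wₜ = A ∘ (t ·_)
      Wᵣ = A ∘ (r ·_)
      S′ = S ∩ Wᵣ ∘ (_- s)

      ∣S⊟Wᵣ∣≤∣Wₜ⊟Wᵣ∣ : size (S ⊟ Wᵣ) ≤ size (Wₜ ⊟ Wᵣ)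
      ∣S⊟Wᵣ∣≤∣Wₜ⊟Wᵣ∣ = size-mono {P = S ⊟ Wᵣ} {Wₜ ⊟ Wᵣ} (⊟-mono {S} {Wₜ} {Wᵣ} {Wᵣ} S⊆Wₜ (λ h → h))

      S′⊟S′⊆Wᵣ⊟Wᵣ : S′ ⊟ S′ ⊆ Wᵣ ⊟ Wᵣ
      S′⊟S′⊆Wᵣ⊟Wᵣ {z} h with ⊟-elim {S′} {S′} h
      ... | v , S′v , S′zv = ⊟-intro {Wᵣ} {Wᵣ} (v - s) (proj₂ (Equivalence.to T-∧ S′v))
                               (subst (T ∘ Wᵣ) (assoc z v (s ⁻¹)) (proj₂ (Equivalence.to T-∧ S′zv)))

    Chain : ℕ → List ℕ → Set
    Chain t rs = ∃ λ S → S ⊆ A ∘ (t ·_)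
                       × All.All (λ r → S ⊟ S ⊆ A ∘ (r ·_) ⊟ A ∘ (r ·_)) (t ∷ rs)
                       × n ^ (length rs * E) * n ≤ d ^ (length rs * E) * size S

    chain-extend : ∀ {t r rs} → Admissible m t → Admissible m r → Chain t rs → Chain t (r ∷ rs)
    chain-extend {t} {r} {rs} t-ok r-ok (S , S⊆Wₜ , S-differences , bound) =
      extend (refine {S} {t} {r} t-ok r-ok S⊆Wₜ)
      where
      extend : Refinement S r → Chain t (r ∷ rs)
      extend (S′ , S′⊆S , S′⊟S′⊆Wᵣ⊟Wᵣ , step) = S′ , S⊆Wₜ ∘ S′⊆S , S′-differences ,
        (begin
          n ^ (E + k * E) * n        ≡⟨ cong (_* n) (^-distribˡ-+-* n E (k * E)) ⟩
          n ^ E * n ^ (k * E) * n    ≡⟨ *-assoc (n ^ E) (n ^ (k * E)) n ⟩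
          n ^ E * (n ^ (k * E) * n)  ≤⟨ *-monoʳ-≤ (n ^ E) bound ⟩
          n ^ E * (d ^ (k * E) * size S)  ≡⟨ *-x∙yz≈y∙xz (n ^ E) (d ^ (k * E)) (size S) ⟩
          d ^ (k * E) * (n ^ E * size S)  ≤⟨ *-monoʳ-≤ (d ^ (k * E)) step ⟩
          d ^ (k * E) * (d ^ E * size S′) ≡⟨ *-x∙yz≈y∙xz (d ^ (k * E)) (d ^ E) (size S′) ⟩
          d ^ E * (d ^ (k * E) * size S′) ≡⟨ *-assoc (d ^ E) (d ^ (k * E)) (size S′) ⟨
          d ^ E * d ^ (k * E) * size S′   ≡⟨ cong (_* size S′) (^-distribˡ-+-* d E (k * E)) ⟨
          d ^ (E + k * E) * size S′  ∎)
        where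
        open ≤-Reasoning
        k : ℕ
        k = length rs
        S′⊟S′⊆ : ∀ {W} → S ⊟ S ⊆ W → S′ ⊟ S′ ⊆ W
        S′⊟S′⊆ S⊟S⊆W = S⊟S⊆W ∘ ⊟-mono {S′} {S} {S′} {S} S′⊆S S′⊆S

        S′-differences : All.All (λ r → S′ ⊟ S′ ⊆ A ∘ (r ·_) ⊟ A ∘ (r ·_)) (t ∷ r ∷ rs)
        S′-differences = S′⊟S′⊆ (All.head S-differences)
                   All.∷ S′⊟S′⊆Wᵣ⊟Wᵣ
                   All.∷ All.map S′⊟S′⊆ (All.tail S-differences)

    chain : ∀ {t} → Admissible m t → ∀ rs → All.All (Admissible m) rs → Chain t rs
    chain {t} (_ , t⊥N) [] All.[] =
      A ∘ (t ·_) , (λ h → h) , (λ h → h) All.∷ All.[] , *-monoʳ-≤ 1 (size≤size-preimage-· t⊥N A)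
    chain t-ok (r ∷ rs) (r-ok All.∷ rs-ok) = chain-extend t-ok r-ok (chain t-ok rs rs-ok)

    nonempty-difference-set-growth : ∀ {t rs} → Admissible m t → All.All (Admissible m) rs →
      ¬ (∃ λ y → y ≢ ε × All.All (λ r → T ((A ⊟ A) (r · y))) (t ∷ rs)) →
      n ^ (2 ^ suc (length rs) * m) * n ≤ d ^ (2 ^ suc (length rs) * m)
    nonempty-difference-set-growth {t} {rs} t-ok rs-ok no-common-dilate = grow (chain t-ok rs rs-ok)
      where
      k M : ℕ
      k = length rs
      M = 2 ^ suc k * m

      kE≤M : k * E ≤ M
      kE≤M = ≤-trans (*-monoˡ-≤ E (n≤2^n k)) (≤-reflexive (*-double (2 ^ k) m))

      grow : Chain t rs → n ^ M * n ≤ d ^ M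
      grow (S , _ , S-differences , bound) = subst (n ^ M * n ≤_) (*-identityʳ (d ^ M))
        (raise-exponent (size≤size-difference 0<∣A∣) kE≤M
          (≤-trans bound (*-monoʳ-≤ (d ^ (k * E)) (≮⇒≥ ∣S∣≯1))))
        where
        ∣S∣≯1 : ¬ 1 < size S
        ∣S∣≯1 1<∣S∣ = no-common-dilate (common-dilate (size>1⇒distinct {P = S} 1<∣S∣))
          where
          common-dilate : (∃₂ λ u v → u ≢ v × T (S u) × T (S v)) →
                          ∃ λ y → y ≢ ε × All.All (λ r → T ((A ⊟ A) (r · y))) (t ∷ rs)
          common-dilate (u , v , u≢v , Su , Sv) =
            u - v , u≢v ∘ x∙y⁻¹≈ε⇒x≈y u v ,
            All.map (λ {r} S⊟S⊆ → ⊟-preimage-· r A (S⊟S⊆ (⊟⁺ {S} {S} Su Sv))) S-differences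

  difference-set-growth : ∀ {A m t rs} → Admissible m t → All.All (Admissible m) rs →
    ¬ (∃ λ y → y ≢ ε × All.All (λ r → T ((A ⊟ A) (r · y))) (t ∷ rs)) →
    size A ^ (2 ^ suc (length rs) * m + 1) ≤ size (A ⊟ A) ^ (2 ^ suc (length rs) * m)
  difference-set-growth {A} {m} {t} {rs} t-ok rs-ok no-common-dilate =
    ^-+1-bound (size A) (2 ^ suc (length rs) * m) λ 0<∣A∣ →
      nonempty-difference-set-growth {A} {m} 0<∣A∣ t-ok rs-ok no-common-dilate

  lookup-⊟ : ∀ {A D : Subset N} →
             (∀ x → x ∈ D ⇔ (∃ λ a → ∃ λ b → a ∈ A × b ∈ A × x ≡ a - b)) →
             lookup A ⊟ lookup A ≐ lookup D
  lookup-⊟ {A} {D} D≡A-A = to , from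
    where
    to : lookup A ⊟ lookup A ⊆ lookup D
    to {z} h with ⊟-elim {lookup A} {lookup A} h
    ... | w , Aw , Azw = Equivalence.to ∈⇔T-lookup (Equivalence.from (D≡A-A z)
      (z ∙ w , w , Equivalence.from ∈⇔T-lookup Azw , Equivalence.from ∈⇔T-lookup Aw ,
       sym (x∙y-y≡x z w)))
    from : lookup D ⊆ lookup A ⊟ lookup A
    from {z} h with Equivalence.to (D≡A-A z) (Equivalence.from ∈⇔T-lookup h)
    ... | a , b , a∈A , b∈A , refl =
      ⊟⁺ {lookup A} {lookup A} (Equivalence.to ∈⇔T-lookup a∈A) (Equivalence.to ∈⇔T-lookup b∈A)

lemma4p2 : (m q N : ℕ) (T : List ℕ) →
    Unique T → length T ≡ q → 1 ≤ q →
    All (λ t → 0 < t × t < m × Coprime t N) T →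
    0 < N →
    (_∙_ : Op₂ (Fin N)) (ε : Fin N) (_⁻¹ : Op₁ (Fin N)) →
    IsAbelianGroup _≡_ _∙_ ε _⁻¹ →
    (A D : Subset N) →
    (∀ x → (x ∈ D) ⇔ (∃ λ a → ∃ λ b → a ∈ A × b ∈ A × x ≡ a ∙ (b ⁻¹))) →
    ¬ (∃ λ y → y ≢ ε × (∀ t → t ∈ₗ T → times _∙_ ε t y ∈ D)) →
    ∣ A ∣ ^ ((2 ^ q) * m + 1) ≤ ∣ D ∣ ^ ((2 ^ q) * m)
lemma4p2 m _ N []       _ refl () _ _ _ _ _ _ _ _ _ _
lemma4p2 m _ N (t ∷ rs) _ refl _ ((_ , t-ok) ∷ rs-valid) _ _ _ _ isAbelianGroup A D D≡A-A no-common-dilate =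
  subst₂ (λ a b → a ^ (M + 1) ≤ b ^ M) (size-lookup A) (trans (size-cong A-A≐D) (size-lookup D))
    (difference-set-growth t-ok (All.map proj₂ rs-valid) no-common-dilate′)
  where
  open FiniteAbelianGroup isAbelianGroup
  M : ℕ
  M = 2 ^ suc (length rs) * m

  A-A≐D : lookup A ⊟ lookup A ≐ lookup D
  A-A≐D = lookup-⊟ {A} {D} D≡A-A

  no-common-dilate′ : ¬ (∃ λ y → y ≢ ε × All (λ r → T ((lookup A ⊟ lookup A) (r · y))) (t ∷ rs))
  no-common-dilate′ (y , y≢ε , dilates) = no-common-dilate (y , y≢ε , λ r r∈ →
    subst (_∈ D) (sym (times≡· r y))
      (Equivalence.from ∈⇔T-lookup (proj₁ A-A≐D (All.lookup dilates r∈))))
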